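{- Let $m,n\ge 1$ be integers, $G=K_m\Box K_n$, and let $S$ be a vertex cut of $G$. Let $C_1,\dots,C_k$ be the components of $G-S$ (so $k=\omega(G-S)$), and for $t\in[k]$ let $\Pi_1(t)=\{i : (i,j)\in C_t \text{ for some } j\}$ and $\Pi_2(t)=\{j : (i,j)\in C_t \text{ for some } i\}$. Suppose that at least one of the following holds: (i) $\sum_{t=1}^{k}|\Pi_1(t)|<m$ or $\sum_{t=1}^{k}|\Pi_2(t)|<n$; (ii) $\omega(G-S)\ge 3$. Then the induced subgraph $G[S]$ is connected.
   Context: $K_m \Box K_n$ has vertex set $[m]\times[n]$, with $(i,j)$ and $(i',j')$ adjacent iff either $i=i'$ and $j\neq j'$, or $j=j'$ and $i\ne i'$. A vertex cut is a set $S$ of vertices such that $G-S$ is disconnected; $\omega(H)$ denotes the number of components of a graph $H$, and $G[S]$ the subgraph induced by $S$. -}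

module Defs where

open import Data.Nat using (ℕ; _<_; _≤_)
open import Data.Fin using (Fin)
open import Data.Fin.Properties using (any?) renaming (_≟_ to _≟ᶠ_)
open import Data.Fin.Subset using (Subset; ∣_∣)
open import Data.Bool using (Bool; true; false)
open import Data.Bool.Properties renaming (_≟_ to _≟ᵇ_)
open import Data.Product using (_×_; _,_; ∃; ∃-syntax)
open import Data.Product.Properties using () 
open import Data.Sum using (_⊎_)
open import Data.List using (List; map; allFin)
open import Data.Nat.ListAction using (sum)
import Data.Vec as Vec
open import Relation.Nullary using (¬_; does)
open import Relation.Nullary.Decidable using (_×-dec_)
open import Relation.Binary.PropositionalEquality using (_≡_; _≢_)
open import Function.Bundles using (_⇔_)

V : ℕ → ℕ → Set
V m n = Fin m × Fin n

Adj : ∀ {m n} → V m n → V m n → Set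
Adj (i , j) (i' , j') = (i ≡ i' × j ≢ j') ⊎ (j ≡ j' × i ≢ i')

-- A vertex set is a Boolean predicate on V m n.
-- Reach P u v : there is a walk from u to v in the induced subgraph G[P].
data Reach {m n} (P : V m n → Bool) : V m n → V m n → Set where
  here  : ∀ {u} → P u ≡ true → Reach P u u
  step  : ∀ {u w v} → P u ≡ true → Adj u w → Reach P w v → Reach P u v

compl : ∀ {m n} → (V m n → Bool) → V m n → Bool
compl S v = Data.Bool.not (S v)

InducedConnected : ∀ {m n} → (V m n → Bool) → Set
InducedConnected P = ∀ u v → P u ≡ true → P v ≡ true → Reach P u v

VertexCut : ∀ {m n} → (V m n → Bool) → Set
VertexCut S = ∃[ u ] ∃[ v ] (S u ≡ false × S v ≡ false × ¬ Reach (compl S) u v)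

-- c labels the components of G - S by Fin k: the classes C_t = {v ∉ S | c v = t}
-- are exactly the components (c u ≡ c v iff u,v connected in G - S), all nonempty.
-- Thus k = ω(G - S). Labels of vertices in S are irrelevant.
IsComponentLabelling : ∀ {m n} → (V m n → Bool) → (k : ℕ) → (V m n → Fin k) → Set
IsComponentLabelling S k c =
  (∀ u v → S u ≡ false → S v ≡ false → (c u ≡ c v ⇔ Reach (compl S) u v))
  × (∀ t → ∃[ v ] (S v ≡ false × c v ≡ t))

Π₁ : ∀ {m n k} → (V m n → Bool) → (V m n → Fin k) → Fin k → Subset m
Π₁ {m} {n} S c t = Vec.tabulate λ i →
  does (any? {n} (λ j → (S (i , j) ≟ᵇ false) ×-dec (c (i , j) ≟ᶠ t)))

Π₂ : ∀ {m n k} → (V m n → Bool) → (V m n → Fin k) → Fin k → Subset n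
Π₂ {m} {n} S c t = Vec.tabulate λ j →
  does (any? {m} (λ i → (S (i , j) ≟ᵇ false) ×-dec (c (i , j) ≟ᶠ t)))

sumΠ₁ : ∀ {m n} k → (V m n → Bool) → (V m n → Fin k) → ℕ
sumΠ₁ k S c = sum (map (λ t → ∣ Π₁ S c t ∣) (allFin k))

sumΠ₂ : ∀ {m n} k → (V m n → Bool) → (V m n → Fin k) → ℕ
sumΠ₂ k S c = sum (map (λ t → ∣ Π₂ S c t ∣) (allFin k))

-- If S contains a whole row (or column) of the grid, every vertex of S reaches it in one
-- step, so G[S] is connected. Otherwise every row meets G − S, so every row index lies in
-- some Π₁(t) and Σ|Π₁(t)| ≥ m; this rules out (i), and symmetrically for columns. Under (ii)
-- with every row meeting G − S, take s = (i, j), s' = (i', j') in S, components C, C' meeting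
-- rows i and i', and a vertex (a, b) of a third component. The vertices (i, b) and (i', b)
-- share a row with C or C' and a column with (a, b), so they cannot lie outside S, and
-- s, (i, b), (i', b), s' is a walk in G[S].
module Submission where

open import Defs
open import Data.Nat using (ℕ; zero; suc; _+_; _<_; _≤_; z≤n; s≤s)
open import Data.Nat.Properties using (≤-refl; ≤-reflexive; ≤-trans; m≤n⇒m≤1+n; +-mono-≤; +-suc; <⇒≱)
open import Data.Fin using (Fin; zero; suc) renaming (_≟_ to _≟ᶠ_)
open import Data.Fin.Properties using (any?; all?; ¬∀⟶∃¬)
open import Data.Fin.Subset using (Subset; ∣_∣; _∪_; ⋃; ⊤; _∈_; inside; outside)
open import Data.Fin.Subset.Properties using (∣⊥∣≡0; ∣⊤∣≡n; p⊆q⇒∣p∣≤∣q∣; x∈p∪q⁺)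
open import Data.Bool using (Bool; true; false; not)
open import Data.Bool.Properties using (¬-not) renaming (_≟_ to _≟ᵇ_)
open import Data.Sum using (_⊎_; inj₁; inj₂)
import Data.Sum as Sum
open import Data.Product using (_×_; _,_; ∃-syntax; proj₁; proj₂; swap)
open import Data.List using (List; []; _∷_; map; allFin)
open import Data.List.Relation.Unary.Any using (here; there)
open import Data.List.Membership.Propositional using () renaming (_∈_ to _∈ˡ_)
open import Data.List.Membership.Propositional.Properties using (∈-allFin)
open import Data.Nat.ListAction using (sum)
open import Data.Vec using ([]; _∷_)
open import Data.Vec.Properties using (lookup∘tabulate; lookup⇒[]=)
open import Data.Empty using (⊥-elim)
open import Relation.Nullary using (yes; no)
open import Relation.Nullary.Decidable using (dec-true)
open import Relation.Binary.PropositionalEquality using (_≡_; _≢_; refl; sym; trans; cong)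
open import Function using (_∘_)
open import Function.Bundles using (Equivalence)

module _ {m n : ℕ} {P : V m n → Bool} where

  reach-alongRow : ∀ {i j j' v} → P (i , j) ≡ true → Reach P (i , j') v → Reach P (i , j) v
  reach-alongRow {j = j} {j'} p r with j ≟ᶠ j'
  ... | yes refl = r
  ... | no j≢j' = step p (inj₁ (refl , j≢j')) r

  reach-alongColumn : ∀ {i i' j v} → P (i , j) ≡ true → Reach P (i' , j) v → Reach P (i , j) v
  reach-alongColumn {i = i} {i'} p r with i ≟ᶠ i'
  ... | yes refl = r
  ... | no i≢i' = step p (inj₂ (refl , i≢i')) r

  Reach-swap : ∀ {u v} → Reach P u v → Reach (P ∘ swap) (swap u) (swap v)
  Reach-swap (here p) = here p
  Reach-swap (step p adj r) = step p (Sum.swap adj) (Reach-swap r)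

InducedConnected-swap : ∀ {m n} {S : V m n → Bool} → InducedConnected (S ∘ swap) → InducedConnected S
InducedConnected-swap conn u v su sv = Reach-swap (conn (swap u) (swap v) su sv)

∣p∪q∣≤∣p∣+∣q∣ : ∀ {n} (p q : Subset n) → ∣ p ∪ q ∣ ≤ ∣ p ∣ + ∣ q ∣
∣p∪q∣≤∣p∣+∣q∣ []            []            = z≤n
∣p∪q∣≤∣p∣+∣q∣ (inside  ∷ p) (inside  ∷ q) rewrite +-suc ∣ p ∣ ∣ q ∣ = s≤s (m≤n⇒m≤1+n (∣p∪q∣≤∣p∣+∣q∣ p q))
∣p∪q∣≤∣p∣+∣q∣ (inside  ∷ p) (outside ∷ q) = s≤s (∣p∪q∣≤∣p∣+∣q∣ p q)
∣p∪q∣≤∣p∣+∣q∣ (outside ∷ p) (inside  ∷ q) rewrite +-suc ∣ p ∣ ∣ q ∣ = s≤s (∣p∪q∣≤∣p∣+∣q∣ p q)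
∣p∪q∣≤∣p∣+∣q∣ (outside ∷ p) (outside ∷ q) = ∣p∪q∣≤∣p∣+∣q∣ p q

module _ {A : Set} {n : ℕ} (f : A → Subset n) where

  ∣⋃∣≤sum : (xs : List A) → ∣ ⋃ (map f xs) ∣ ≤ sum (map (∣_∣ ∘ f) xs)
  ∣⋃∣≤sum [] rewrite ∣⊥∣≡0 n = z≤n
  ∣⋃∣≤sum (x ∷ xs) = ≤-trans (∣p∪q∣≤∣p∣+∣q∣ (f x) _) (+-mono-≤ ≤-refl (∣⋃∣≤sum xs))

  ∈⋃ : ∀ {i a} {xs : List A} → a ∈ˡ xs → i ∈ f a → i ∈ ⋃ (map f xs)
  ∈⋃ (here refl) i∈fa = x∈p∪q⁺ (inj₁ i∈fa)
  ∈⋃ (there a∈xs) i∈fa = x∈p∪q⁺ (inj₂ (∈⋃ a∈xs i∈fa))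

  covering⇒≤sum : (xs : List A) → (∀ i → ∃[ a ] (a ∈ˡ xs × i ∈ f a)) → n ≤ sum (map (∣_∣ ∘ f) xs)
  covering⇒≤sum xs cover = ≤-trans n≤∣⋃∣ (∣⋃∣≤sum xs)
    where
    n≤∣⋃∣ : n ≤ ∣ ⋃ (map f xs) ∣
    n≤∣⋃∣ = ≤-trans (≤-reflexive (sym (∣⊤∣≡n n)))
                    (p⊆q⇒∣p∣≤∣q∣ {p = ⊤} λ {i} _ → let a , a∈xs , i∈fa = cover i in ∈⋃ a∈xs i∈fa)

module _ {m n : ℕ} (S : V m n → Bool) where

  FullRow : Set
  FullRow = ∃[ r ] (∀ j → S (r , j) ≡ true)

  RowsMeetComplement : Set
  RowsMeetComplement = ∀ i → ∃[ j ] S (i , j) ≡ false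

  fullRow⇒connected : FullRow → InducedConnected S
  fullRow⇒connected (r , full) (i , j) (i' , j') s s' =
    reach-alongColumn s (reach-alongRow (full j) (reach-alongColumn (full j') (here s')))

  fullRow⊎rowsMeetComplement : FullRow ⊎ RowsMeetComplement
  fullRow⊎rowsMeetComplement with any? (λ r → all? (λ j → S (r , j) ≟ᵇ true))
  ... | yes full = inj₁ full
  ... | no ¬full = inj₂ λ i →
    let j , ¬sij = ¬∀⟶∃¬ n _ (λ j → S (i , j) ≟ᵇ true) (λ all-j → ¬full (i , all-j))
    in j , ¬-not ¬sij

  rowsMeetComplement⇒m≤sumΠ₁ : ∀ {k} (c : V m n → Fin k) → RowsMeetComplement → m ≤ sumΠ₁ k S c
  rowsMeetComplement⇒m≤sumΠ₁ {k} c meet = covering⇒≤sum (Π₁ S c) (allFin k) λ i →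
    let j , sij = meet i in
    c (i , j) , ∈-allFin _ , lookup⇒[]= i _ (trans (lookup∘tabulate _ i) (dec-true (any? _) (j , sij , refl)))

  sumΠ₁<m⇒connected : ∀ {k} (c : V m n → Fin k) → sumΠ₁ k S c < m → InducedConnected S
  sumΠ₁<m⇒connected c Σ<m with fullRow⊎rowsMeetComplement
  ... | inj₁ full = fullRow⇒connected full
  ... | inj₂ meet = ⊥-elim (<⇒≱ Σ<m (rowsMeetComplement⇒m≤sumΠ₁ c meet))

  module _ {k : ℕ} {c : V m n → Fin k} (labelling : IsComponentLabelling S k c) where

    corner∈S : ∀ {i j a b} → S (i , j) ≡ false → S (a , b) ≡ false → c (i , j) ≢ c (a , b) →
               S (i , b) ≡ true
    corner∈S {i} {j} {a} {b} sij sab c≢ with S (i , b) in sib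
    ... | true = refl
    ... | false = ⊥-elim (c≢ (trans (sym (sameComponent sij (reach-alongRow (cong not sib) (here (cong not sij)))))
                                     (sameComponent sab (reach-alongColumn (cong not sib) (here (cong not sab))))))
      where
      sameComponent : ∀ {u} → S u ≡ false → Reach (compl S) (i , b) u → c (i , b) ≡ c u
      sameComponent {u} su = Equivalence.from (proj₁ labelling (i , b) u sib su)

third-element : ∀ {k} → 3 ≤ k → (a b : Fin k) → ∃[ w ] (w ≢ a × w ≢ b)
third-element (s≤s (s≤s (s≤s _))) zero          zero          = suc zero , (λ ()) , (λ ())
third-element (s≤s (s≤s (s≤s _))) zero          (suc zero)    = suc (suc zero) , (λ ()) , (λ ())
third-element (s≤s (s≤s (s≤s _))) zero          (suc (suc _)) = suc zero , (λ ()) , (λ ())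
third-element (s≤s (s≤s (s≤s _))) (suc zero)    zero          = suc (suc zero) , (λ ()) , (λ ())
third-element (s≤s (s≤s (s≤s _))) (suc zero)    (suc _)       = zero , (λ ()) , (λ ())
third-element (s≤s (s≤s (s≤s _))) (suc (suc _)) zero          = suc zero , (λ ()) , (λ ())
third-element (s≤s (s≤s (s≤s _))) (suc (suc _)) (suc _)       = zero , (λ ()) , (λ ())

threeComponents⇒connected : ∀ {m n k} {S : V m n → Bool} {c : V m n → Fin k} →
  IsComponentLabelling S k c → 3 ≤ k → RowsMeetComplement S → InducedConnected S
threeComponents⇒connected {S = S} {c} labelling 3≤k meet (i , j) (i' , j') s s' =
  let ji , sij = meet i
      ji' , si'j' = meet i'
      w , w≢ , w≢' = third-element 3≤k (c (i , ji)) (c (i' , ji'))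
      (a , b) , sab , cab≡w = proj₂ labelling w
      ib∈S = corner∈S S labelling sij sab λ e → w≢ (trans (sym cab≡w) (sym e))
      i'b∈S = corner∈S S labelling si'j' sab λ e → w≢' (trans (sym cab≡w) (sym e))
  in reach-alongRow s (reach-alongColumn ib∈S (reach-alongRow i'b∈S (here s')))

-- The vertex-cut hypothesis and m, n ≥ 1 are not needed, and case (i) holds for any labelling c.
lemma2p4 : (m n : ℕ) → 1 ≤ m → 1 ≤ n → (S : V m n → Bool) → VertexCut S →
    (k : ℕ) (c : V m n → Fin k) → IsComponentLabelling S k c →
    ((sumΠ₁ k S c < m ⊎ sumΠ₂ k S c < n) ⊎ 3 ≤ k) →
    InducedConnected S
lemma2p4 m n _ _ S _ k c _ (inj₁ (inj₁ Σ₁<m)) = sumΠ₁<m⇒connected S c Σ₁<m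
-- sumΠ₂ k S c is definitionally sumΠ₁ k (S ∘ swap) (c ∘ swap).
lemma2p4 m n _ _ S _ k c _ (inj₁ (inj₂ Σ₂<n)) =
  InducedConnected-swap (sumΠ₁<m⇒connected (S ∘ swap) (c ∘ swap) Σ₂<n)
lemma2p4 m n _ _ S _ k c labelling (inj₂ 3≤k) with fullRow⊎rowsMeetComplement S
... | inj₁ full = fullRow⇒connected S full
... | inj₂ meet = threeComponents⇒connected labelling 3≤k meet
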